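{- Fix an integer $h\ge 2$ and let $f:\mathbb{N}\to\mathbb{N}$ be a map with $f(n)\to\infty$ as $n\to\infty$ and $f(n)=o(n^{h-1})$ as $n\to\infty$. Identify $\mathcal{P}(\mathbb{N})$ with the Cantor space $\{0,1\}^{\mathbb{N}}$. Then the family of all sets $A\subseteq\mathbb{N}$ such that $$\liminf_{n\to\infty} r_{A,h}(n)=0\quad\text{and}\quad \limsup_{n\to\infty}\frac{r_{A,h}(n)}{f(n)}=\infty$$ is comeager in $\mathcal{P}(\mathbb{N})$.
   Context: Here $\mathbb{N}=\{0,1,2,\ldots\}$. For $A\subseteq\mathbb{N}$, an integer $h\ge 2$ and $x\in\mathbb{N}$, $r_{A,h}(x)$ denotes the number of solutions $(a_1,\ldots,a_h)\in A^h$ of $x=a_1+\cdots+a_h$, where two solutions are considered the same if they differ only in the ordering of the summands. The topology on $\mathcal{P}(\mathbb{N})$ is the product topology of $\{0,1\}^{\mathbb{N}}$ via characteristic functions. -}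

module Defs where

open import Data.Nat using (ℕ; zero; suc; _+_; _*_; _∸_; _^_; _≤_; _<_; _≡ᵇ_)
open import Data.Bool using (Bool; true; false; if_then_else_)
open import Data.List using (List; map; upTo)
open import Data.Nat.ListAction using (sum)
open import Data.Product using (Σ; _×_; ∃)
open import Relation.Binary.PropositionalEquality using (_≡_)

Subset : Set
Subset = ℕ → Bool

-- count A k lo n = number of non-decreasing k-tuples lo ≤ a₁ ≤ … ≤ aₖ
-- with all aᵢ ∈ A and a₁ + … + aₖ = n  (i.e. multisets of size k).
count : Subset → ℕ → ℕ → ℕ → ℕ
count A zero    lo n = if n ≡ᵇ 0 then 1 else 0
count A (suc k) lo n =
  sum (map (λ i → if A (lo + i) then count A k (lo + i) (n ∸ (lo + i)) else 0)
           (upTo (suc n ∸ lo)))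

r : Subset → ℕ → ℕ → ℕ
r A h n = count A h 0 n

AgreeUpTo : ℕ → Subset → Subset → Set
AgreeUpTo m A B = ∀ i → i < m → B i ≡ A i

IsOpen : (Subset → Set) → Set
IsOpen U = ∀ A → U A → Σ ℕ λ m → ∀ B → AgreeUpTo m A B → U B

IsDense : (Subset → Set) → Set
IsDense U = ∀ A m → Σ Subset λ B → AgreeUpTo m A B × U B

Comeager : (Subset → Set) → Set₁
Comeager F = Σ (ℕ → Subset → Set) λ U →
  ((k : ℕ) → IsOpen (U k)) × ((k : ℕ) → IsDense (U k)) ×
  (∀ A → (∀ k → U k A) → F A)

TendsToInfinity : (ℕ → ℕ) → Set
TendsToInfinity f = ∀ M → Σ ℕ λ N → ∀ n → N ≤ n → M ≤ f n

LittleO-pow : (ℕ → ℕ) → ℕ → Set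
LittleO-pow f e = ∀ k → 1 ≤ k → Σ ℕ λ N → ∀ n → N ≤ n → k * f n ≤ n ^ e

-- liminf_{n} g(n) = 0 (for ℕ-valued g: g(n) = 0 infinitely often)
LiminfZero : (ℕ → ℕ) → Set
LiminfZero g = ∀ N → Σ ℕ λ n → N ≤ n × g n ≡ 0

LimsupRatioInfinite : (ℕ → ℕ) → (ℕ → ℕ) → Set
LimsupRatioInfinite g f = ∀ M N → Σ ℕ λ n → N ≤ n × M * f n < g n

{-# OPTIONS --safe #-}
-- Let U_k be the set of A with r_{A,h}(n) = 0 for some n ≥ k and r_{A,h}(n) > k f(n) for
-- some n ≥ k; the sets lying in every U_k have the two properties. U_k is open since
-- r_{A,h}(n) only depends on A ∩ [0, n]. It is dense: keep a prefix A ∩ [0, m), add nothing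
-- on [m, L) and everything from L on. Then r vanishes at every n with hm < n < L, while at
-- n = hL + h²t the h − 1 smallest summands can be chosen freely, each less than t above the
-- previous one (the first less than t above L), so r ≥ t^(h−1), which beats k f(n) for large t because f(n) = o(n^(h−1)) and n = O(t).
module Submission where

open import Defs
open import Data.Bool using (true; false; if_then_else_)
open import Data.List using ([]; _∷_; applyUpTo)
open import Data.List.Properties using (map-upTo)
open import Data.Nat
open import Data.Nat.ListAction using (sum)
open import Data.Nat.Properties
open import Data.Nat.Tactic.RingSolver using (solve)
open import Data.Product using (Σ; _×_; _,_; proj₁; proj₂)
open import Function using (_∘_)
open import Relation.Binary.PropositionalEquality
open import Relation.Nullary using (yes; no; contradiction)
open import Relation.Nullary.Decidable using (⌊_⌋)

sum-applyUpTo-cong : ∀ {g g′ : ℕ → ℕ} N → (∀ i → i < N → g i ≡ g′ i) →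
                     sum (applyUpTo g N) ≡ sum (applyUpTo g′ N)
sum-applyUpTo-cong zero    _  = refl
sum-applyUpTo-cong (suc N) eq =
  cong₂ _+_ (eq 0 z<s) (sum-applyUpTo-cong N (λ i i<N → eq (suc i) (s<s i<N)))

sum-applyUpTo-≡0 : ∀ {g : ℕ → ℕ} N → (∀ i → i < N → g i ≡ 0) → sum (applyUpTo g N) ≡ 0
sum-applyUpTo-≡0 zero    _  = refl
sum-applyUpTo-≡0 (suc N) eq rewrite eq 0 z<s = sum-applyUpTo-≡0 N (λ i i<N → eq (suc i) (s<s i<N))

*-≤-sum-applyUpTo : ∀ {g : ℕ → ℕ} {x} N a t → a + t ≤ N → (∀ i → i < t → x ≤ g (a + i)) →
                    t * x ≤ sum (applyUpTo g N)
*-≤-sum-applyUpTo {g} (suc N) (suc a) t (s≤s a+t≤N) large =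
  ≤-trans (*-≤-sum-applyUpTo N a t a+t≤N large) (m≤n+m _ (g 0))
*-≤-sum-applyUpTo N zero zero _ _ = z≤n
*-≤-sum-applyUpTo (suc N) zero (suc t) (s≤s t≤N) large =
  +-mono-≤ (large 0 z<s) (*-≤-sum-applyUpTo N zero t t≤N (λ i i<t → large (suc i) (s<s i<t)))

summand : Subset → ℕ → ℕ → ℕ → ℕ → ℕ
summand A k lo n i = if A (lo + i) then count A k (lo + i) (n ∸ (lo + i)) else 0

count-suc : ∀ A k lo n → count A (suc k) lo n ≡ sum (applyUpTo (summand A k lo n) (suc n ∸ lo))
count-suc A k lo n = cong sum (map-upTo (summand A k lo n) (suc n ∸ lo))

m<1+n∸o⇒o+m≤n : ∀ {m n o} → m < suc n ∸ o → o + m ≤ n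
m<1+n∸o⇒o+m≤n {o = zero}              m<1+n = ≤-pred m<1+n
m<1+n∸o⇒o+m≤n {n = suc n} {o = suc o} m<   = s≤s (m<1+n∸o⇒o+m≤n m<)
m<1+n∸o⇒o+m≤n {m} {n = zero} {o = suc o} m< = contradiction (subst (m <_) (0∸n≡0 o) m<) λ ()

count-local : ∀ {A B M} k lo n → AgreeUpTo M A B → n < M → count A k lo n ≡ count B k lo n
count-local zero lo n _ _ = refl
count-local {A} {B} (suc k) lo n agree n<M rewrite count-suc A k lo n | count-suc B k lo n =
  sum-applyUpTo-cong (suc n ∸ lo) λ i i<1+n∸lo →
    cong₂ (λ b c → if b then c else 0)
      (sym (agree (lo + i) (≤-<-trans (m<1+n∸o⇒o+m≤n i<1+n∸lo) n<M)))
      (count-local k (lo + i) (n ∸ (lo + i)) agree (≤-<-trans (m∸n≤m n (lo + i)) n<M))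

count-≡0 : ∀ {B m} k lo n → (∀ i → B i ≡ true → i ≤ n → i < m) → k * m < n → count B k lo n ≡ 0
count-≡0 zero lo (suc n) _ _ = refl
count-≡0 {B} {m} (suc k) lo n small km<n rewrite count-suc B k lo n =
  sum-applyUpTo-≡0 (suc n ∸ lo) λ i i<1+n∸lo → summand≡0 (lo + i) (m<1+n∸o⇒o+m≤n i<1+n∸lo)
  where
  summand≡0 : ∀ a → a ≤ n → (if B a then count B k a (n ∸ a) else 0) ≡ 0
  summand≡0 a a≤n with B a in Ba
  ... | false = refl
  ... | true  = count-≡0 k a (n ∸ a) (λ i Bi i≤n∸a → small i Bi (≤-trans i≤n∸a (m∸n≤m n a)))
                  (m+n≤o⇒m≤o∸n (suc (k * m)) (<⇒≤ room))
    where
    open ≤-Reasoning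
    room : suc (k * m) + a < n
    room = begin-strict
      suc (k * m) + a ≡⟨ +-suc (k * m) a ⟨
      k * m + suc a   ≤⟨ +-monoʳ-≤ (k * m) (small a Ba a≤n) ⟩
      k * m + m       ≡⟨ +-comm (k * m) m ⟩
      suc k * m       <⟨ km<n ⟩
      n               ∎

count-suc-≥ : ∀ {D k lo n x} a t → lo ≤ a → a + t ≤ suc n →
              (∀ i → i < t → D (a + i) ≡ true × x ≤ count D k (a + i) (n ∸ (a + i))) →
              t * x ≤ count D (suc k) lo n
count-suc-≥ {D} {k} {lo} {n} {x} a t lo≤a a+t≤1+n terms rewrite count-suc D k lo n =
  *-≤-sum-applyUpTo (suc n ∸ lo) (a ∸ lo) t window summand-≥
  where
  window : a ∸ lo + t ≤ suc n ∸ lo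
  window = ≤-trans (≤-reflexive (sym (+-∸-comm t lo≤a))) (∸-monoˡ-≤ lo a+t≤1+n)
  summand-≥ : ∀ i → i < t → x ≤ summand D k lo n (a ∸ lo + i)
  summand-≥ i i<t
    rewrite sym (+-assoc lo (a ∸ lo) i) | m+[n∸m]≡n lo≤a | proj₁ (terms i i<t) = proj₂ (terms i i<t)

-- The smallest summand can be any of b, …, b + t − 1; the bound on n is designed to be
-- inherited by the remaining j summands (see budget).
count-≥-^ : ∀ {D} j {lo b t n} → (∀ i → b ≤ i → D i ≡ true) → lo ≤ b →
            suc j * b + suc j * suc j * t ≤ n → t ^ j ≤ count D (suc j) lo n
count-≥-^ {D} zero {lo} {b} {t} {n} full lo≤b bound =
  count-suc-≥ {D} {0} n 1 (≤-trans lo≤b b≤n) (≤-reflexive (+-comm n 1)) λ where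
    zero    _        → last-summand
    (suc _) (s≤s ())
  where
  b≤n : b ≤ n
  b≤n = ≤-trans (m≤n*m b 1) (≤-trans (m≤m+n _ _) bound)
  last-summand : D (n + 0) ≡ true × 1 ≤ count D 0 (n + 0) (n ∸ (n + 0))
  last-summand rewrite +-identityʳ n | n∸n≡0 n = full n b≤n , ≤-refl
count-≥-^ {D} (suc j) {lo} {b} {t} {n} full lo≤b bound =
  count-suc-≥ {D} {suc j} b t lo≤b b+t≤1+n λ i i<t →
    full (b + i) (m≤m+n b i) , count-≥-^ j (λ a b+i≤a → full a (≤-trans (m≤m+n b i) b+i≤a)) ≤-refl
                                 (m+n≤o⇒m≤o∸n _ (≤-trans (budget i (<⇒≤ i<t)) bound))
  where
  open ≤-Reasoning
  b+t≤1+n : b + t ≤ suc n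
  b+t≤1+n = ≤-trans (+-mono-≤ (m≤n*m b (suc (suc j))) (m≤n*m t (suc (suc j) * suc (suc j))))
                    (≤-trans bound (n≤1+n n))
  budget : ∀ i → i ≤ t → suc j * (b + i) + suc j * suc j * t + (b + i)
                          ≤ suc (suc j) * b + suc (suc j) * suc (suc j) * t
  budget i i≤t = begin
    suc j * (b + i) + suc j * suc j * t + (b + i)
      ≡⟨ solve (j ∷ b ∷ i ∷ t ∷ []) ⟩
    suc (suc j) * (b + i) + suc j * suc j * t
      ≤⟨ +-monoˡ-≤ _ (*-monoʳ-≤ (suc (suc j)) (+-monoʳ-≤ b i≤t)) ⟩
    suc (suc j) * (b + t) + suc j * suc j * t
      ≤⟨ m≤m+n _ (suc j * t) ⟩
    suc (suc j) * (b + t) + suc j * suc j * t + suc j * t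
      ≡⟨ solve (j ∷ b ∷ t ∷ []) ⟩
    suc (suc j) * b + suc (suc j) * suc (suc j) * t ∎

^-distribʳ-* : ∀ m n o → (m * n) ^ o ≡ m ^ o * n ^ o
^-distribʳ-* m n zero    = refl
^-distribʳ-* m n (suc o) rewrite ^-distribʳ-* m n o = [m*n]*[o*p]≡[m*o]*[n*p] m n (m ^ o) (n ^ o)

suc-*-≤⇒*-< : ∀ k x {y} → suc k * x ≤ y → 0 < y → k * x < y
suc-*-≤⇒*-< k zero    _  0<y rewrite *-zeroʳ k = 0<y
suc-*-≤⇒*-< k (suc x) le _   = <-≤-trans (*-monoˡ-< (suc x) (n<1+n k)) le

littleO-pow-affine : ∀ {f j} → LittleO-pow f j → ∀ k a b .{{_ : NonZero b}} →
                     Σ ℕ λ T → ∀ t → T ≤ t → k * f (a + b * t) < t ^ j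
littleO-pow-affine {f} {j} littleO k a b = suc (N + a) , below
  where
  K : ℕ
  K = suc b ^ j * suc k
  1≤K : 1 ≤ K
  1≤K = *-mono-≤ (m^n>0 (suc b) j) (s≤s z≤n)
  N : ℕ
  N = proj₁ (littleO K 1≤K)
  below : ∀ t → suc (N + a) ≤ t → k * f (a + b * t) < t ^ j
  below t N+a<t = suc-*-≤⇒*-< k (f n) (*-cancelˡ-≤ (suc b ^ j) {{m^n≢0 (suc b) j}} scaled)
                    (m^n>0 t {{>-nonZero (<-≤-trans z<s N+a<t)}} j)
    where
    open ≤-Reasoning
    n : ℕ
    n = a + b * t
    N≤n : N ≤ n
    N≤n = ≤-trans (m≤m+n N a) (≤-trans (<⇒≤ N+a<t) (≤-trans (m≤n*m t b) (m≤n+m _ a)))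
    a≤t : a ≤ t
    a≤t = ≤-trans (m≤n+m a N) (<⇒≤ N+a<t)
    scaled : suc b ^ j * (suc k * f n) ≤ suc b ^ j * t ^ j
    scaled = begin
      suc b ^ j * (suc k * f n) ≡⟨ *-assoc (suc b ^ j) (suc k) (f n) ⟨
      K * f n                   ≤⟨ proj₂ (littleO K 1≤K) n N≤n ⟩
      n ^ j                     ≤⟨ ^-monoˡ-≤ j (+-monoˡ-≤ (b * t) a≤t) ⟩
      (suc b * t) ^ j           ≡⟨ ^-distribʳ-* (suc b) t j ⟩
      suc b ^ j * t ^ j         ∎

glue : Subset → ℕ → ℕ → Subset
glue A m g i = if ⌊ i <? m ⌋ then A i else ⌊ m + g ≤? i ⌋

glue-agrees : ∀ A m g → AgreeUpTo m A (glue A m g)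
glue-agrees A m g i i<m with i <? m
... | yes _   = refl
... | no i≮m = contradiction i<m i≮m

glue-full : ∀ A m g i → m + g ≤ i → glue A m g i ≡ true
glue-full A m g i m+g≤i with i <? m | m + g ≤? i
... | yes i<m | _         = contradiction (≤-trans (m≤m+n m g) m+g≤i) (<⇒≱ i<m)
... | no _    | yes _     = refl
... | no _    | no m+g≰i = contradiction m+g≤i m+g≰i

glue-gap : ∀ A m g i → glue A m g i ≡ true → i < m + g → i < m
glue-gap A m g i glue≡true i<m+g with i <? m | m + g ≤? i
... | yes i<m | _         = i<m
... | no _    | yes m+g≤i = contradiction i<m+g (≤⇒≯ m+g≤i)
... | no _    | no _      = contradiction glue≡true λ ()

AgreeUpTo-≤ : ∀ {m m′ A B} → m ≤ m′ → AgreeUpTo m′ A B → AgreeUpTo m A B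
AgreeUpTo-≤ m≤m′ agree i i<m = agree i (<-≤-trans i<m m≤m′)

isOpen-× : ∀ {U V : Subset → Set} → IsOpen U → IsOpen V → IsOpen (λ A → U A × V A)
isOpen-× U-open V-open A (u , v) =
  let (m , U-near) = U-open A u ; (m′ , V-near) = V-open A v in
  m + m′ , λ B agree → U-near B (AgreeUpTo-≤ (m≤m+n m m′) agree) ,
                       V-near B (AgreeUpTo-≤ (m≤n+m m′ m) agree)

isOpen-∃-r : ∀ h (P : ℕ → ℕ → Set) → IsOpen (λ A → Σ ℕ λ n → P n (r A h n))
isOpen-∃-r h P A (n , p) = suc n , λ B agree → n , subst (P n) (count-local {A} {B} h 0 n agree ≤-refl) p

VanishesBeyond : ℕ → ℕ → Subset → Set
VanishesBeyond h k A = Σ ℕ λ n → k ≤ n × r A h n ≡ 0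

ExceedsBeyond : ℕ → (ℕ → ℕ) → ℕ → Subset → Set
ExceedsBeyond h f k A = Σ ℕ λ n → k ≤ n × k * f n < r A h n

limsupRatioInfinite : ∀ {h f A} → (∀ k → ExceedsBeyond h f k A) → LimsupRatioInfinite (r A h) f
limsupRatioInfinite {f = f} exceeds M N =
  let (n , M+N≤n , exceeds-n) = exceeds (M + N) in
  n , ≤-trans (m≤n+m N M) M+N≤n , ≤-<-trans (*-monoˡ-≤ (f n) (m≤m+n M N)) exceeds-n

isDense-beyond : ∀ e {f} → LittleO-pow f e → ∀ k →
                 IsDense (λ A → VanishesBeyond (suc e) k A × ExceedsBeyond (suc e) f k A)
isDense-beyond e {f} littleO k A m =
  glue A m g , glue-agrees A m g , (n₀ , k≤n₀ , vanishes) , (n₁ , k≤n₁ , exceeds)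
  where
  h = suc e
  n₀ = suc (k + h * m)
  g = suc n₀
  L = m + g
  eventually-below = littleO-pow-affine {f} {e} littleO k (h * L) (h * h)
  T = proj₁ eventually-below
  t = T + k
  n₁ = h * L + h * h * t
  k≤n₀ : k ≤ n₀
  k≤n₀ = ≤-trans (m≤m+n k _) (n≤1+n _)
  k≤n₁ : k ≤ n₁
  k≤n₁ = ≤-trans (m≤n+m k T) (≤-trans (m≤n*m t (h * h)) (m≤n+m _ (h * L)))
  vanishes : r (glue A m g) h n₀ ≡ 0
  vanishes = count-≡0 h 0 n₀
    (λ i glue≡true i≤n₀ → glue-gap A m g i glue≡true (≤-<-trans i≤n₀ (m≤n+m g m)))
    (s≤s (m≤n+m _ k))
  exceeds : k * f n₁ < r (glue A m g) h n₁
  exceeds = <-≤-trans (proj₂ eventually-below t (m≤m+n T k))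
                      (count-≥-^ e (glue-full A m g) z≤n ≤-refl)

comeager-liminf-limsup : ∀ e {f} → LittleO-pow f e →
  Comeager (λ A → LiminfZero (r A (suc e)) × LimsupRatioInfinite (r A (suc e)) f)
comeager-liminf-limsup e {f} littleO =
    (λ k A → VanishesBeyond (suc e) k A × ExceedsBeyond (suc e) f k A)
  , (λ k → isOpen-× (isOpen-∃-r (suc e) (λ n x → k ≤ n × x ≡ 0))
                    (isOpen-∃-r (suc e) (λ n x → k ≤ n × k * f n < x)))
  , isDense-beyond e littleO
  , λ A beyond → proj₁ ∘ beyond , limsupRatioInfinite {suc e} {f} {A} (proj₂ ∘ beyond)

theorem1p2 : (h : ℕ) → 2 ≤ h → (f : ℕ → ℕ) →
    TendsToInfinity f → LittleO-pow f (h ∸ 1) →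
    Comeager (λ A → LiminfZero (r A h) × LimsupRatioInfinite (r A h) f)
theorem1p2 zero    ()
theorem1p2 (suc e) _ f _ littleO = comeager-liminf-limsup e littleO
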